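{- A cycle (regarded as a graph) fails to be $2s$-repeating for every $s\in\mathbb{N}$.
   Context: For $q\in\mathbb{N}$, a closed walk $(v_0,v_1,\dots,v_r=v_0)$ is $q$-repeating if there exist $0\le t<t'\le r-1$ with $t\equiv t'\pmod q$ and $v_t=v_{t'}$. A graph is $q$-repeating if for every integer $j\ge2$, every closed walk on it of length $jq$ (number of edges, counted with repetition) is $q$-repeating. -}

module Defs where

open import Data.Nat using (ℕ; zero; suc; _+_; _*_; _∸_; _<_; _≤_; _%_; NonZero)
open import Data.Nat.Divisibility using (_∣_)
open import Data.Fin using (Fin; toℕ)
open import Data.Product using (∃-syntax; _×_)
open import Data.Sum using (_⊎_)
open import Relation.Binary.PropositionalEquality using (_≡_)

-- A closed walk of length r (number of edges) is a sequence v₀,…,v_r of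
-- vertices (encoded as w : ℕ → V, only w 0 … w r matter) with consecutive
-- vertices adjacent and v_r = v₀.
IsClosedWalk : {V : Set} (Adj : V → V → Set) (r : ℕ) (w : ℕ → V) → Set
IsClosedWalk Adj r w = (∀ i → i < r → Adj (w i) (w (suc i))) × (w r ≡ w 0)

IsRepeatingWalk : {V : Set} (q r : ℕ) (w : ℕ → V) → Set
IsRepeatingWalk q r w =
  ∃[ t ] ∃[ t' ] (t < t') × (t' < r) × (q ∣ (t' ∸ t)) × (w t ≡ w t')

IsRepeatingGraph : {V : Set} (Adj : V → V → Set) (q : ℕ) → Set
IsRepeatingGraph {V} Adj q =
  ∀ (j : ℕ) → 2 ≤ j → (w : ℕ → V) → IsClosedWalk Adj (j * q) w → IsRepeatingWalk q (j * q) w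

CycleAdj : (n : ℕ) .{{_ : NonZero n}} → Fin n → Fin n → Set
CycleAdj n a b = (toℕ b ≡ (suc (toℕ a)) % n) ⊎ (toℕ a ≡ (suc (toℕ b)) % n)

-- On the cycle C_N (N ≥ 3) with q = 2(s+1), let j ≥ 2 be the additive order of 2 modulo N.
-- The "zigzag" walk spends each block of q steps oscillating between the positions 2a and
-- 2a+1 of ℕ and then steps on to 2a+2; reduced mod N it is a closed walk of length jq.
-- Its positions at times t and t + kq differ by exactly 2k, so a q-repetition would give
-- some 0 < k < j with N ∣ 2k, contradicting the choice of j.
module Submission where

open import Defs
open import Relation.Nullary using (¬_; contradiction)
open import Data.Nat using (ℕ; zero; suc; pred; _*_; _+_; _∸_; _<_; _≤_; _/_; _%_; NonZero; z≤n; s≤s)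
open import Data.Nat.Solver using (module +-*-Solver)
open import Data.Nat.Properties
open import Data.Nat.DivMod
open import Data.Nat.Divisibility using (_∣_; divides; ∣⇒≤; ∣-refl; n∣m⇒m%n≡0)
open import Data.Fin using (Fin; toℕ)
open import Data.Fin.Properties using (toℕ-fromℕ<; toℕ-injective)
open import Data.Product using (_,_; _×_; ∃-syntax)
open import Data.Sum using (_⊎_; inj₁; inj₂)
open import Function using (_∘_)
open import Relation.Binary.PropositionalEquality
open ≡-Reasoning

PathAdj : ℕ → ℕ → Set
PathAdj x y = y ≡ suc x ⊎ x ≡ suc y

PathAdj-+ʳ : ∀ {x y} c → PathAdj x y → PathAdj (x + c) (y + c)
PathAdj-+ʳ c (inj₁ refl) = inj₁ refl
PathAdj-+ʳ c (inj₂ refl) = inj₂ refl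

%≡%+⇒∣ : ∀ x d N .{{_ : NonZero N}} → x % N ≡ (x + d) % N → N ∣ d
%≡%+⇒∣ x d N eq = divides ((x + d) / N ∸ x / N) (begin
    d                                                 ≡⟨ sym (m+n∸m≡n x d) ⟩
    (x + d) ∸ x                                       ≡⟨ cong₂ _∸_ (m≡m%n+[m/n]*n (x + d) N) (m≡m%n+[m/n]*n x N) ⟩
    ((x + d) % N + (x + d) / N * N) ∸ (x % N + x / N * N)
      ≡⟨ cong (λ r → (r + (x + d) / N * N) ∸ (x % N + x / N * N)) (sym eq) ⟩
    (x % N + (x + d) / N * N) ∸ (x % N + x / N * N)   ≡⟨ [m+n]∸[m+o]≡n∸o (x % N) _ _ ⟩
    (x + d) / N * N ∸ x / N * N                       ≡⟨ sym (*-distribʳ-∸ N ((x + d) / N) (x / N)) ⟩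
    ((x + d) / N ∸ x / N) * N                         ∎)

module _ (N : ℕ) .{{_ : NonZero N}} where

  toℕ-mod : ∀ x → toℕ (x mod N) ≡ x % N
  toℕ-mod x = toℕ-fromℕ< (m%n<n x N)

  toℕ-suc-mod : ∀ x → toℕ (suc x mod N) ≡ suc (toℕ (x mod N)) % N
  toℕ-suc-mod x = begin
      toℕ (suc x mod N)               ≡⟨ toℕ-mod (suc x) ⟩
      suc x % N                       ≡⟨ cong (λ y → suc y % N) (m≡m%n+[m/n]*n x N) ⟩
      (suc (x % N) + x / N * N) % N   ≡⟨ [m+kn]%n≡m%n (suc (x % N)) (x / N) N ⟩
      suc (x % N) % N                 ≡⟨ cong (λ r → suc r % N) (sym (toℕ-mod x)) ⟩
      suc (toℕ (x mod N)) % N         ∎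

  mod-preserves-adjacency : ∀ {x y} → PathAdj x y → CycleAdj N (x mod N) (y mod N)
  mod-preserves-adjacency {x} (inj₁ refl) = inj₁ (toℕ-suc-mod x)
  mod-preserves-adjacency {y = y} (inj₂ refl) = inj₂ (toℕ-suc-mod y)

  ∣⇒mod≡0 : ∀ {d} → N ∣ d → d mod N ≡ 0 mod N
  ∣⇒mod≡0 {d} N∣d = toℕ-injective (begin
      toℕ (d mod N)   ≡⟨ toℕ-mod d ⟩
      d % N           ≡⟨ n∣m⇒m%n≡0 d N N∣d ⟩
      0               ≡⟨ m*n%n≡0 0 N ⟨
      0 % N           ≡⟨ toℕ-mod 0 ⟨
      toℕ (0 mod N)   ∎)

  mod≡mod+⇒∣ : ∀ x d → x mod N ≡ (x + d) mod N → N ∣ d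
  mod≡mod+⇒∣ x d eq =
    %≡%+⇒∣ x d N (trans (sym (toℕ-mod x)) (trans (cong toℕ eq) (toℕ-mod (x + d))))

alternating : ℕ → ℕ
alternating zero = 0
alternating (suc zero) = 1
alternating (suc (suc n)) = alternating n

alternating-adj : ∀ n → PathAdj (alternating n) (alternating (suc n))
alternating-adj zero = inj₁ refl
alternating-adj (suc zero) = inj₂ refl
alternating-adj (suc (suc n)) = alternating-adj n

alternating-odd : ∀ n → alternating (suc (2 * n)) ≡ 1
alternating-odd zero = refl
alternating-odd (suc n) = trans (cong (alternating ∘ suc) (*-suc 2 n)) (alternating-odd n)

module Zigzag (s : ℕ) where

  q : ℕ
  q = 2 * suc s

  zigzag : ℕ → ℕ
  zigzag t = 2 * (t / q) + alternating (t % q)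

  zigzag-+-blocks : ∀ t k → zigzag (t + k * q) ≡ zigzag t + 2 * k
  zigzag-+-blocks t k = begin
      2 * ((t + k * q) / q) + alternating ((t + k * q) % q)
        ≡⟨ cong₂ (λ a b → 2 * a + alternating b)
             (trans (+-distrib-/-∣ʳ t (divides k refl)) (cong (t / q +_) (m*n/n≡m k q)))
             ([m+kn]%n≡m%n t k q) ⟩
      2 * (t / q + k) + alternating (t % q)
        ≡⟨ solve 3 (λ a b c → con 2 :* (a :+ b) :+ c := con 2 :* a :+ c :+ con 2 :* b)
             refl (t / q) k (alternating (t % q)) ⟩
      zigzag t + 2 * k ∎
    where open +-*-Solver

  zigzag-within-block : ∀ u a → u < q → zigzag (u + a * q) ≡ alternating u + 2 * a
  zigzag-within-block u a u<q = begin
      zigzag (u + a * q)   ≡⟨ zigzag-+-blocks u a ⟩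
      zigzag u + 2 * a     ≡⟨ cong₂ (λ b r → 2 * b + alternating r + 2 * a) (m<n⇒m/n≡0 u<q) (m<n⇒m%n≡m u<q) ⟩
      alternating u + 2 * a ∎

  zigzag-adj-within-block : ∀ u a → u < q → PathAdj (zigzag (u + a * q)) (zigzag (suc u + a * q))
  zigzag-adj-within-block u a u<q with m≤n⇒m<n∨m≡n u<q
  ... | inj₁ 1+u<q = subst₂ PathAdj (sym (zigzag-within-block u a u<q)) (sym (zigzag-within-block (suc u) a 1+u<q))
                       (PathAdj-+ʳ (2 * a) (alternating-adj u))
  ... | inj₂ refl = inj₁ (begin
      zigzag (0 + suc a * q)                  ≡⟨ zigzag-+-blocks 0 (suc a) ⟩
      2 * suc a                               ≡⟨ *-suc 2 a ⟩
      suc (1 + 2 * a)                         ≡⟨ cong (λ r → suc (r + 2 * a)) (alternating-odd s) ⟨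
      suc (alternating (suc (2 * s)) + 2 * a) ≡⟨ cong (λ r → suc (alternating (pred r) + 2 * a)) (*-suc 2 s) ⟨
      suc (alternating u + 2 * a)             ≡⟨ cong suc (zigzag-within-block u a u<q) ⟨
      suc (zigzag (u + a * q))                ∎)

  zigzag-adj : ∀ t → PathAdj (zigzag t) (zigzag (suc t))
  zigzag-adj t = subst (λ t → PathAdj (zigzag t) (zigzag (suc t))) (sym (m≡m%n+[m/n]*n t q))
                   (zigzag-adj-within-block (t % q) (t / q) (m%n<n t q))

  module _ (N : ℕ) .{{_ : NonZero N}} where

    walk : ℕ → Fin N
    walk t = zigzag t mod N

    walk-isClosedWalk : ∀ j → N ∣ 2 * j → IsClosedWalk (CycleAdj N) (j * q) walk
    walk-isClosedWalk j N∣2j =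
        (λ t _ → mod-preserves-adjacency N (zigzag-adj t))
      , trans (cong (_mod N) (zigzag-+-blocks 0 j)) (∣⇒mod≡0 N N∣2j)

    walk-repeating⇒∣2* : ∀ {r} → IsRepeatingWalk q r walk →
                       ∃[ k ] 0 < k × k * q < r × N ∣ 2 * k
    walk-repeating⇒∣2* {r} (t , t' , t<t' , t'<r , divides k t'∸t≡kq , same) = k , 0<k , kq<r , N∣2k
      where
        t'≡t+kq : t' ≡ t + k * q
        t'≡t+kq = trans (sym (m+[n∸m]≡n (<⇒≤ t<t'))) (cong (t +_) t'∸t≡kq)
        0<k : 0 < k
        0<k = *-cancelʳ-< q 0 k (subst (0 <_) t'∸t≡kq (m<n⇒0<n∸m t<t'))
        kq<r : k * q < r
        kq<r = ≤-<-trans (m≤n+m (k * q) t) (subst (_< r) t'≡t+kq t'<r)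
        N∣2k : N ∣ 2 * k
        N∣2k = mod≡mod+⇒∣ N (zigzag t) (2 * k)
                 (trans same (cong (_mod N) (trans (cong zigzag t'≡t+kq) (zigzag-+-blocks t k))))

even-or-odd : ∀ n → ∃[ h ] (n ≡ 2 * h ⊎ n ≡ suc (2 * h))
even-or-odd zero = 0 , inj₁ refl
even-or-odd (suc n) with even-or-odd n
... | h , inj₁ n≡2h = h , inj₂ (cong suc n≡2h)
... | h , inj₂ n≡1+2h = suc h , inj₁ (trans (cong suc n≡1+2h) (sym (*-suc 2 h)))

IsOrderOfTwoMod : ℕ → ℕ → Set
IsOrderOfTwoMod N j = N ∣ 2 * j × (∀ k → 0 < k → N ∣ 2 * k → j ≤ k)

orderOfTwoMod-even : ∀ h → IsOrderOfTwoMod (2 * h) h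
orderOfTwoMod-even h = ∣-refl , minimal
  where
    minimal : ∀ k → 0 < k → 2 * h ∣ 2 * k → h ≤ k
    minimal (suc k) _ 2h∣2k = *-cancelˡ-≤ 2 (∣⇒≤ 2h∣2k)

orderOfTwoMod-odd : ∀ h → IsOrderOfTwoMod (suc (2 * h)) (suc (2 * h))
orderOfTwoMod-odd h = divides 2 refl , minimal
  where
    N = suc (2 * h)
    minimal : ∀ k → 0 < k → N ∣ 2 * k → N ≤ k
    minimal k 0<k (divides zero 2k≡0) = contradiction (subst (0 <_) 2k≡0 (*-monoʳ-< 2 0<k)) (<-irrefl refl)
    minimal k _ (divides 1 2k≡N) = contradiction (trans 2k≡N (+-identityʳ N)) (even≢odd k h)
    minimal k _ (divides (suc (suc c)) 2k≡[2+c]N) =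
      *-cancelˡ-≤ 2 (subst (2 * N ≤_) (sym 2k≡[2+c]N) (*-monoˡ-≤ N {2} {suc (suc c)} (s≤s (s≤s z≤n))))

orderOfTwoMod-≥2 : ∀ m → ∃[ j ] 2 ≤ j × IsOrderOfTwoMod (suc (suc (suc m))) j
orderOfTwoMod-≥2 m with even-or-odd (suc (suc (suc m)))
... | suc (suc h) , inj₁ N≡2h =
  suc (suc h) , s≤s (s≤s z≤n) , subst (λ N → IsOrderOfTwoMod N (suc (suc h))) (sym N≡2h) (orderOfTwoMod-even _)
... | h , inj₂ N≡1+2h =
  suc (suc (suc m)) , s≤s (s≤s z≤n) , subst (λ N → IsOrderOfTwoMod N N) (sym N≡1+2h) (orderOfTwoMod-odd h)

proposition7 : (m s : ℕ) →
    ¬ IsRepeatingGraph (CycleAdj (suc (suc (suc m)))) (2 * suc s)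
proposition7 m s repeating =
  let j , 2≤j , N∣2j , minimal = orderOfTwoMod-≥2 m
      k , 0<k , kq<jq , N∣2k = walk-repeating⇒∣2* N (repeating j 2≤j (walk N) (walk-isClosedWalk N j N∣2j))
  in <⇒≱ (*-cancelʳ-< q k j kq<jq) (minimal k 0<k N∣2k)
  where
    N = suc (suc (suc m))
    open Zigzag s
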